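{- For an integer $n\ge 2$ let $$A_n=\Big\{(x_1,\dots,x_n)\in\mathbb{Z}^n:\ n\ge x_1\ge x_2\ge\cdots\ge x_n\ge 0,\ \sum_{i=1}^k x_i\le 2n+6k-16 \text{ for all } k\in\{1,\dots,n\},\ \text{and } \sum_{i=1}^n x_i\le 6n-12\Big\},$$ and let $S_n(x_1,\dots,x_n)=\sum_{1\le i<j\le n}x_ix_j^2$. If $(x_1,\dots,x_n)\in A_n$ maximizes $S_n$ over $A_n$, then at least one of the following holds: (i) $x_1=n$; (ii) $x_2\le \frac{n}{18}$; (iii) there exists an integer $k\le 11664$ such that $x_i\le 6$ for all $i>k$. -}

module Defs where

open import Data.Nat using (ℕ; zero; suc)
open import Data.Fin using (Fin; toℕ; _<_)
open import Data.Integer using (ℤ; +_; _+_; _*_; _-_; _≤_)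
open import Data.Product using (_×_)

-- A point (x₁,…,xₙ) ∈ ℤⁿ is a function Fin n → ℤ; index i : Fin n
-- stands for x_{toℕ i + 1}.

sumTo : (ℕ → ℤ) → ℕ → ℤ
sumTo f zero    = + 0
sumTo f (suc m) = sumTo f m + f m

ext : ∀ {n} → (Fin n → ℤ) → ℕ → ℤ
ext {zero}  x m       = + 0
ext {suc n} x zero    = x Data.Fin.zero
ext {suc n} x (suc m) = ext {n} (λ i → x (Data.Fin.suc i)) m

prefix : ∀ {n} → (Fin n → ℤ) → ℕ → ℤ
prefix x k = sumTo (ext x) k

InA : (n : ℕ) → (Fin n → ℤ) → Set
InA n x =
  (∀ (i : Fin n) → x i ≤ + n)
  × (∀ (i j : Fin n) → i < j → x j ≤ x i)
  × (∀ (i : Fin n) → + 0 ≤ x i)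
  × (∀ (k : ℕ) → 1 Data.Nat.≤ k → k Data.Nat.≤ n →
       prefix x k ≤ (+ (2 Data.Nat.* n) + + (6 Data.Nat.* k)) - + 16)
  × (prefix x n ≤ + (6 Data.Nat.* n) - + 12)

S : (n : ℕ) → (Fin n → ℤ) → ℤ
S n x = sumTo (λ j → sumTo (λ i → ext x i * (ext x j * ext x j)) j) n

open import Data.Nat.Properties using (≤-trans; n≤1+n)

first : ∀ {n} → 2 Data.Nat.≤ n → Fin n
first {n} p = Data.Fin.fromℕ< {0} {n} (≤-trans (n≤1+n 1) p)

second : ∀ {n} → 2 Data.Nat.≤ n → Fin n
second {n} p = Data.Fin.fromℕ< {1} {n} p

module Submission where

-- Suppose x₁ < n, 18 x₂ > n and x_{11665} ≥ 7 (otherwise (i), (ii) or, by monotonicity,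
-- (iii) with k = 11664 holds), and let x_{m+1} be the last entry that is at least 7, so
-- m ≥ 11664.  Moving one unit from each of x_m, x_{m+1} to each of x₁, x₂ stays in A_n:
-- the order survives because x_{m+2} ≤ 6; the k-th prefix sum grows by at most 2 (by 1
-- for k = m, by 0 for k > m), while the bound 2n + 6k - 16 has slack m + 1 - k there,
-- since all entries up to x_{m+1} exceed its growth 6 per step.  The move increases S_n:
-- writing c = x_m and P = x₁ + ⋯ + x_{m-1}, the gain is a sum of nonnegative terms as
-- soon as c·P < x₂² and 4c ≤ x₂, and both follow from m·c ≤ Σ x ≤ 6n, P ≤ 6n and
-- m ≥ 11664 = 108², e.g. m·c·P ≤ (6n)² < (108 x₂)² ≤ m·x₂².

open import Defs
open import Data.Nat using (ℕ; _≥_; s≤s; z≤n)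
open import Data.Fin using (Fin; toℕ; fromℕ<)
open import Data.Integer using (ℤ; +_; _*_; _≤_)
open import Data.Product using (∃-syntax; _×_)
open import Data.Sum using (_⊎_)
open import Relation.Binary.PropositionalEquality using (_≡_)

open import Data.Nat using (zero; suc)
import Data.Nat as ℕ
import Data.Nat.Properties as ℕ
import Data.Fin as Fin
import Data.Fin.Properties as Finₚ
open import Data.Integer using (_+_; _-_; -_; _<_; +≤+; -≤+; +<+; nonNegative; positive)
import Data.Integer.Properties as ℤ
open import Data.Integer.Tactic.RingSolver using (solve-∀)
open import Data.Product using (_,_; proj₁; proj₂)
open import Data.Sum using (inj₁; inj₂)
open import Function using (_∘_)
open import Relation.Binary using (tri<; tri≈; tri>)
open import Relation.Binary.PropositionalEquality
  using (_≢_; refl; sym; trans; cong; cong₂; subst; subst₂; module ≡-Reasoning)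
open import Relation.Nullary using (Dec; yes; no; ¬_; contradiction)
open import Relation.Unary using (Decidable)

*-nonNeg : ∀ {i j : ℤ} → + 0 ≤ i → + 0 ≤ j → + 0 ≤ i * j
*-nonNeg {+ m} {+ n} _ _ = subst (+ 0 ≤_) (ℤ.pos-* m n) (+≤+ z≤n)

*-mono-≤-nonNeg : ∀ {i i′ j j′ : ℤ} → + 0 ≤ i → i ≤ i′ → + 0 ≤ j → j ≤ j′ → i * j ≤ i′ * j′
*-mono-≤-nonNeg {i} {i′} {j} {j′} 0≤i i≤i′ 0≤j j≤j′ =
  ℤ.≤-trans (ℤ.*-monoʳ-≤-nonNeg j {{nonNegative 0≤j}} i≤i′)
            (ℤ.*-monoˡ-≤-nonNeg i′ {{nonNegative (ℤ.≤-trans 0≤i i≤i′)}} j≤j′)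

i≤i+j-nonNeg : ∀ (i : ℤ) {j} → + 0 ≤ j → i ≤ i + j
i≤i+j-nonNeg i 0≤j = ℤ.i≤i+j i _ {{nonNegative 0≤j}}

square-< : ∀ {i j : ℤ} → + 0 ≤ i → i < j → i * i < j * j
square-< {i} {j} 0≤i i<j =
  ℤ.≤-<-trans (ℤ.*-monoˡ-≤-nonNeg i {{nonNegative 0≤i}} (ℤ.<⇒≤ i<j))
              (ℤ.*-monoʳ-<-pos j {{positive (ℤ.≤-<-trans 0≤i i<j)}} i<j)

i<j⇒i+1≤j : ∀ {i j : ℤ} → i < j → i + + 1 ≤ j
i<j⇒i+1≤j {i} i<j = subst (_≤ _) (ℤ.+-comm (+ 1) i) (ℤ.i<j⇒suc[i]≤j i<j)

sumTo-cong : ∀ {u w : ℕ → ℤ} m → (∀ j → j ℕ.< m → u j ≡ w j) → sumTo u m ≡ sumTo w m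
sumTo-cong zero    u≡w = refl
sumTo-cong (suc m) u≡w =
  cong₂ _+_ (sumTo-cong m (λ j j<m → u≡w j (ℕ.m<n⇒m<1+n j<m))) (u≡w m ℕ.≤-refl)

sumTo-*ʳ : ∀ (u : ℕ → ℤ) c m → sumTo (λ j → u j * c) m ≡ sumTo u m * c
sumTo-*ʳ u c zero    = sym (ℤ.*-zeroˡ c)
sumTo-*ʳ u c (suc m) =
  trans (cong (_+ u m * c) (sumTo-*ʳ u c m)) (sym (ℤ.*-distribʳ-+ c (sumTo u m) (u m)))

sumTo-monoʳ-≤ : ∀ (u : ℕ → ℤ) {k} m → (∀ j → j ℕ.< m → + 0 ≤ u j) → k ℕ.≤ m → sumTo u k ≤ sumTo u m
sumTo-monoʳ-≤ u zero    0≤u z≤n = ℤ.≤-refl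
sumTo-monoʳ-≤ u (suc m) 0≤u k≤1+m with ℕ.m≤n⇒m<n∨m≡n k≤1+m
... | inj₂ refl = ℤ.≤-refl
... | inj₁ k<1+m = ℤ.≤-trans (sumTo-monoʳ-≤ u m (λ j j<m → 0≤u j (ℕ.m<n⇒m<1+n j<m)) (ℕ.≤-pred k<1+m))
                              (i≤i+j-nonNeg (sumTo u m) (0≤u m ℕ.≤-refl))

*-≤-sumTo : ∀ (u : ℕ → ℤ) c m → (∀ j → j ℕ.< m → c ≤ u j) → + m * c ≤ sumTo u m
*-≤-sumTo u c zero    c≤u = ℤ.≤-reflexive (ℤ.*-zeroˡ c)
*-≤-sumTo u c (suc m) c≤u =
  subst (_≤ sumTo u m + u m) (sym (trans (cong (_* c) (ℤ.pos-+ 1 m)) (1+m*c≡m*c+c (+ m) c)))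
        (ℤ.+-mono-≤ (*-≤-sumTo u c m (λ j j<m → c≤u j (ℕ.m<n⇒m<1+n j<m))) (c≤u m ℕ.≤-refl))
  where
  1+m*c≡m*c+c : ∀ m c → (+ 1 + m) * c ≡ m * c + c
  1+m*c≡m*c+c = solve-∀

sumTo-cong-except : ∀ {u w : ℕ → ℤ} {r} m → (∀ j → j ≢ r → u j ≡ w j) → m ℕ.≤ r → sumTo u m ≡ sumTo w m
sumTo-cong-except m u≡w m≤r = sumTo-cong m (λ j j<m → u≡w j (ℕ.<⇒≢ (ℕ.<-≤-trans j<m m≤r)))

sumTo-change-at : ∀ {u w : ℕ → ℤ} {r} m → (∀ j → j ≢ r → u j ≡ w j) → r ℕ.< m →
                  sumTo u m ≡ sumTo w m + (u r - w r)
sumTo-change-at {u} {w} {r} (suc m) u≡w r<1+m with ℕ.m≤n⇒m<n∨m≡n (ℕ.≤-pred r<1+m)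
... | inj₂ refl = trans (cong (_+ u r) (sumTo-cong-except r u≡w ℕ.≤-refl)) (shift (sumTo w r) (u r) (w r))
  where
  shift : ∀ s x y → s + x ≡ (s + y) + (x - y)
  shift = solve-∀
... | inj₁ r<m = trans (cong₂ _+_ (sumTo-change-at m u≡w r<m) (u≡w m (ℕ.>⇒≢ r<m)))
                       (swap (sumTo w m) (u r - w r) (w m))
  where
  swap : ∀ s d x → s + d + x ≡ (s + x) + d
  swap = solve-∀

sumTo-slack : ∀ (u B : ℕ → ℤ) δ m → (∀ k → B (suc k) ≤ B k + δ) → (∀ j → j ℕ.< m → + 1 + δ ≤ u j) →
              sumTo u m ≤ B m → ∀ k t → k ℕ.+ t ≡ m → sumTo u k + + t ≤ B k
sumTo-slack u B δ m B-step u-big sum≤B k zero    refl =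
  subst (_≤ B k) (sym (ℤ.+-identityʳ _)) (subst (λ s → sumTo u s ≤ B s) (ℕ.+-identityʳ k) sum≤B)
sumTo-slack u B δ m B-step u-big sum≤B k (suc t) k+1+t≡m = begin
  sumTo u k + (+ 1 + + t)
    ≡⟨ shuffle (sumTo u k) δ (+ t) ⟩
  (sumTo u k + (+ 1 + δ) + + t) - δ
    ≤⟨ ℤ.+-monoˡ-≤ (- δ) (ℤ.+-monoˡ-≤ (+ t) (ℤ.+-monoʳ-≤ (sumTo u k) (u-big k k<m))) ⟩
  (sumTo u (suc k) + + t) - δ
    ≤⟨ ℤ.+-monoˡ-≤ (- δ) (sumTo-slack u B δ m B-step u-big sum≤B (suc k) t 1+k+t≡m) ⟩
  B (suc k) - δ
    ≤⟨ ℤ.+-monoˡ-≤ (- δ) (B-step k) ⟩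
  (B k + δ) - δ
    ≡⟨ cancel (B k) δ ⟩
  B k ∎
  where
  open ℤ.≤-Reasoning
  1+k+t≡m : suc k ℕ.+ t ≡ m
  1+k+t≡m = trans (sym (ℕ.+-suc k t)) k+1+t≡m
  k<m : k ℕ.< m
  k<m = subst (k ℕ.<_) k+1+t≡m (ℕ.m<m+n k (s≤s z≤n))
  shuffle : ∀ s δ t → s + (+ 1 + t) ≡ (s + (+ 1 + δ) + t) - δ
  shuffle = solve-∀
  cancel : ∀ b δ → (b + δ) - δ ≡ b
  cancel = solve-∀

sumSq : (ℕ → ℤ) → ℕ → ℤ
sumSq h = sumTo (λ j → h j * h j)

*-sumTo-≤-sumSq : ∀ (u : ℕ → ℤ) {c} k m → + 0 ≤ c → (∀ j → k ℕ.≤ j → j ℕ.< m → c ≤ u j) → k ℕ.≤ m →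
                  c * (sumTo u m - sumTo u k) ≤ sumSq u m - sumSq u k
*-sumTo-≤-sumSq u {c} k zero    0≤c c≤u z≤n   = ℤ.≤-reflexive (ℤ.*-zeroʳ c)
*-sumTo-≤-sumSq u {c} k (suc m) 0≤c c≤u k≤1+m with ℕ.m≤n⇒m<n∨m≡n k≤1+m
... | inj₂ refl = ℤ.≤-reflexive (trans (cong (c *_) (ℤ.+-inverseʳ (sumTo u (suc m))))
                                       (trans (ℤ.*-zeroʳ c) (sym (ℤ.+-inverseʳ (sumSq u (suc m))))))
... | inj₁ k<1+m = begin
  c * ((sumTo u m + u m) - sumTo u k)                ≡⟨ split c (sumTo u m) (u m) (sumTo u k) ⟩
  c * (sumTo u m - sumTo u k) + c * u m              ≤⟨ ℤ.+-mono-≤ (*-sumTo-≤-sumSq u k m 0≤c c≤u′ k≤m)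
                                                                   (*-mono-≤-nonNeg 0≤c c≤um 0≤um ℤ.≤-refl) ⟩
  (sumSq u m - sumSq u k) + u m * u m                ≡⟨ merge (sumSq u m) (sumSq u k) (u m * u m) ⟩
  (sumSq u m + u m * u m) - sumSq u k                ∎
  where
  open ℤ.≤-Reasoning
  k≤m : k ℕ.≤ m
  k≤m = ℕ.≤-pred k<1+m
  c≤u′ : ∀ j → k ℕ.≤ j → j ℕ.< m → c ≤ u j
  c≤u′ j k≤j j<m = c≤u j k≤j (ℕ.m<n⇒m<1+n j<m)
  c≤um : c ≤ u m
  c≤um = c≤u m k≤m ℕ.≤-refl
  0≤um : + 0 ≤ u m
  0≤um = ℤ.≤-trans 0≤c c≤um
  split : ∀ c s x t → c * ((s + x) - t) ≡ c * (s - t) + c * x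
  split = solve-∀
  merge : ∀ q p y → (q - p) + y ≡ (q + y) - p
  merge = solve-∀

infixl 5 _[_]+=_

-- Opaque, so that a client's `with k ℕ.≟ r` cannot abstract over the test inside an
-- unfolded update: updates are used only through +=-at and +=-elsewhere.
opaque
  _[_]+=_ : (ℕ → ℤ) → ℕ → ℤ → ℕ → ℤ
  (h [ r ]+= v) k with k ℕ.≟ r
  ... | yes _ = h k + v
  ... | no  _ = h k

  +=-at : ∀ h r v → (h [ r ]+= v) r ≡ h r + v
  +=-at h r v with r ℕ.≟ r
  ... | yes _   = refl
  ... | no r≢r = contradiction refl r≢r

  +=-elsewhere : ∀ h {r} v {k} → k ≢ r → (h [ r ]+= v) k ≡ h k
  +=-elsewhere h {r} v {k} k≢r with k ℕ.≟ r
  ... | yes k≡r = contradiction k≡r k≢r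
  ... | no  _   = refl

sumTo-+=-≤ : ∀ h {r} v m → m ℕ.≤ r → sumTo (h [ r ]+= v) m ≡ sumTo h m
sumTo-+=-≤ h v m = sumTo-cong-except m (λ j → +=-elsewhere h v)

sumTo-+=-> : ∀ h {r} v m → r ℕ.< m → sumTo (h [ r ]+= v) m ≡ sumTo h m + v
sumTo-+=-> h {r} v m r<m = begin
  sumTo (h [ r ]+= v) m                      ≡⟨ sumTo-change-at m (λ j → +=-elsewhere h v) r<m ⟩
  sumTo h m + ((h [ r ]+= v) r - h r)        ≡⟨ cong (λ t → sumTo h m + (t - h r)) (+=-at h r v) ⟩
  sumTo h m + ((h r + v) - h r)              ≡⟨ cong (λ t → sumTo h m + t) (cancel (h r) v) ⟩
  sumTo h m + v                              ∎
  where
  open ≡-Reasoning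
  cancel : ∀ x v → (x + v) - x ≡ v
  cancel = solve-∀

sumTo-+=-nonNeg : ∀ h {r} {v} m → + 0 ≤ v → sumTo (h [ r ]+= v) m ≤ sumTo h m + v
sumTo-+=-nonNeg h {r} {v} m 0≤v with r ℕ.<? m
... | yes r<m = ℤ.≤-reflexive (sumTo-+=-> h v m r<m)
... | no  r≮m = subst (_≤ sumTo h m + v) (sym (sumTo-+=-≤ h v m (ℕ.≮⇒≥ r≮m))) (i≤i+j-nonNeg (sumTo h m) 0≤v)

sumTo-+=-nonPos : ∀ h {r} {v} m → v ≤ + 0 → sumTo (h [ r ]+= v) m ≤ sumTo h m
sumTo-+=-nonPos h {r} {v} m v≤0 with r ℕ.<? m
... | yes r<m = subst (_≤ sumTo h m) (sym (sumTo-+=-> h v m r<m))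
                      (subst (sumTo h m + v ≤_) (ℤ.+-identityʳ (sumTo h m)) (ℤ.+-monoʳ-≤ (sumTo h m) v≤0))
... | no  r≮m = ℤ.≤-reflexive (sumTo-+=-≤ h v m (ℕ.≮⇒≥ r≮m))

sumSq-+= : ∀ h {r} v m → r ℕ.< m →
           sumSq (h [ r ]+= v) m ≡ sumSq h m + ((h r + v) * (h r + v) - h r * h r)
sumSq-+= h {r} v m r<m =
  trans (sumTo-change-at m (λ j j≢r → cong₂ _*_ (+=-elsewhere h v j≢r) (+=-elsewhere h v j≢r)) r<m)
        (cong (λ t → sumSq h m + (t * t - h r * h r)) (+=-at h r v))

sumSq-tail-+= : ∀ h {r} v m n → r ℕ.< m → r ℕ.< n →
                sumSq (h [ r ]+= v) n - sumSq (h [ r ]+= v) m ≡ sumSq h n - sumSq h m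
sumSq-tail-+= h v m n r<m r<n =
  trans (cong₂ _-_ (sumSq-+= h v n r<n) (sumSq-+= h v m r<m)) (cancel (sumSq h n) (sumSq h m) _)
  where
  cancel : ∀ A B δ → (A + δ) - (B + δ) ≡ A - B
  cancel = solve-∀

S′ : ℕ → (ℕ → ℤ) → ℤ
S′ n h = sumTo (λ j → sumTo (λ i → h i * (h j * h j)) j) n

S′-as-weighted-sum : ∀ n h → S′ n h ≡ sumTo (λ j → sumTo h j * (h j * h j)) n
S′-as-weighted-sum n h = sumTo-cong n (λ j _ → sumTo-*ʳ h (h j * h j) j)

S′-+= : ∀ n h {r} v → r ℕ.< n →
        S′ n (h [ r ]+= v) ≡ S′ n h + v * ((+ 2 * h r + v) * sumTo h r + (sumSq h n - sumSq h (suc r)))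
S′-+= n h {r} v r<n = begin
  S′ n g                                                       ≡⟨ S′-as-weighted-sum n g ⟩
  sumTo (W g) n                                                ≡⟨ weighted n r<n ⟩
  sumTo (W h) n + v * (D + (sumSq h n - sumSq h (suc r)))      ≡⟨ cong (λ s → s + v * (D + (sumSq h n - sumSq h (suc r))))
                                                                       (sym (S′-as-weighted-sum n h)) ⟩
  S′ n h + v * (D + (sumSq h n - sumSq h (suc r)))             ∎
  where
  open ≡-Reasoning
  g : ℕ → ℤ
  g = h [ r ]+= v
  D : ℤ
  D = (+ 2 * h r + v) * sumTo h r
  W : (ℕ → ℤ) → ℕ → ℤ
  W u j = sumTo u j * (u j * u j)

  W-below : ∀ j → j ℕ.< r → W g j ≡ W h j
  W-below j j<r = cong₂ (λ s t → s * (t * t)) (sumTo-+=-≤ h v j (ℕ.<⇒≤ j<r)) (+=-elsewhere h v (ℕ.<⇒≢ j<r))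

  weighted : ∀ m → r ℕ.< m → sumTo (W g) m ≡ sumTo (W h) m + v * (D + (sumSq h m - sumSq h (suc r)))
  weighted (suc m) r<1+m with ℕ.m≤n⇒m<n∨m≡n (ℕ.≤-pred r<1+m)
  ... | inj₂ refl = begin
    sumTo (W g) r + sumTo g r * (g r * g r)
      ≡⟨ cong₂ _+_ (sumTo-cong r W-below)
                   (cong₂ (λ s t → s * (t * t)) (sumTo-+=-≤ h v r ℕ.≤-refl) (+=-at h r v)) ⟩
    sumTo (W h) r + sumTo h r * ((h r + v) * (h r + v))
      ≡⟨ expand (sumTo (W h) r) (sumTo h r) (h r) v (sumSq h (suc r)) ⟩
    (sumTo (W h) r + sumTo h r * (h r * h r)) + v * (D + (sumSq h (suc r) - sumSq h (suc r))) ∎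
    where
    expand : ∀ A P x v Q → A + P * ((x + v) * (x + v)) ≡ (A + P * (x * x)) + v * ((+ 2 * x + v) * P + (Q - Q))
    expand = solve-∀
  ... | inj₁ r<m = begin
    sumTo (W g) m + sumTo g m * (g m * g m)
      ≡⟨ cong₂ _+_ (weighted m r<m)
                   (cong₂ (λ s t → s * (t * t)) (sumTo-+=-> h v m r<m) (+=-elsewhere h v (ℕ.>⇒≢ r<m))) ⟩
    (sumTo (W h) m + v * (D + (sumSq h m - sumSq h (suc r)))) + (sumTo h m + v) * (h m * h m)
      ≡⟨ regroup (sumTo (W h) m) D v (sumSq h m) (sumSq h (suc r)) (sumTo h m) (h m * h m) ⟩
    (sumTo (W h) m + sumTo h m * (h m * h m)) + v * (D + ((sumSq h m + h m * h m) - sumSq h (suc r))) ∎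
    where
    regroup : ∀ A D v S Q P y → (A + v * (D + (S - Q))) + (P + v) * y ≡ (A + P * y) + v * (D + ((S + y) - Q))
    regroup = solve-∀

S′-cong : ∀ n {h h′ : ℕ → ℤ} → (∀ k → k ℕ.< n → h k ≡ h′ k) → S′ n h ≡ S′ n h′
S′-cong n h≡h′ = sumTo-cong n (λ j j<n → sumTo-cong j (λ i i<j →
  cong₂ _*_ (h≡h′ i (ℕ.<-trans i<j j<n)) (cong₂ _*_ (h≡h′ j j<n) (h≡h′ j j<n))))

lastIndex : ∀ {p} {P : ℕ → Set p} → Decidable P → ∀ {k m} → k ℕ.≤ m → P k → ¬ P m →
            ∃[ b ] (k ℕ.≤ b × P b × ¬ P (suc b))
lastIndex P? {m = zero}  z≤n   Pk ¬Pm = contradiction Pk ¬Pm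
lastIndex {P = P} P? {k} {suc m} k≤1+m Pk ¬P1+m = search (P? m)
  where
  k≤m : k ℕ.≤ m
  k≤m = ℕ.≤-pred (ℕ.≤∧≢⇒< k≤1+m (λ k≡1+m → ¬P1+m (subst P k≡1+m Pk)))
  search : Dec (P m) → ∃[ b ] (k ℕ.≤ b × P b × ¬ P (suc b))
  search (yes Pm) = m , k≤m , Pm , ¬P1+m
  search (no ¬Pm) = lastIndex P? k≤m Pk ¬Pm

antitone-from-steps : ∀ (g : ℕ → ℤ) {n} → (∀ k → suc k ℕ.< n → g (suc k) ≤ g k) →
                      ∀ {j k} → j ℕ.≤ k → k ℕ.< n → g k ≤ g j
antitone-from-steps g step {k = zero}  z≤n    _     = ℤ.≤-refl
antitone-from-steps g step {j} {suc k} j≤1+k 1+k<n with ℕ.m≤n⇒m<n∨m≡n j≤1+k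
... | inj₂ refl  = ℤ.≤-refl
... | inj₁ j<1+k = ℤ.≤-trans (step k 1+k<n)
                             (antitone-from-steps g step (ℕ.≤-pred j<1+k) (ℕ.<-trans (ℕ.n<1+n k) 1+k<n))

ext-beyond : ∀ {n} (x : Fin n → ℤ) {k} → n ℕ.≤ k → ext x k ≡ + 0
ext-beyond {zero}  x         _         = refl
ext-beyond {suc n} x {suc k} (s≤s n≤k) = ext-beyond (λ i → x (Fin.suc i)) n≤k

ext-fromℕ< : ∀ {n} (x : Fin n → ℤ) {j} (j<n : j ℕ.< n) → ext x j ≡ x (fromℕ< j<n)
ext-fromℕ< {suc n} x {zero}  _         = refl
ext-fromℕ< {suc n} x {suc j} (s≤s j<n) = ext-fromℕ< (λ i → x (Fin.suc i)) j<n

ext-toℕ : ∀ {n} (x : Fin n → ℤ) i → ext x (toℕ i) ≡ x i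
ext-toℕ x Fin.zero    = refl
ext-toℕ x (Fin.suc i) = ext-toℕ (λ j → x (Fin.suc j)) i

ext-tabulate : ∀ {n} (h : ℕ → ℤ) {k} → k ℕ.< n → ext {n} (λ i → h (toℕ i)) k ≡ h k
ext-tabulate {suc n} h {zero}  _         = refl
ext-tabulate {suc n} h {suc k} (s≤s k<n) = ext-tabulate {n} (λ j → h (suc j)) k<n

prefixBound : ℕ → ℕ → ℤ
prefixBound n k = (+ (2 ℕ.* n) + + (6 ℕ.* k)) - + 16

prefixBound-suc : ∀ n k → prefixBound n (suc k) ≡ prefixBound n k + + 6
prefixBound-suc n k = begin
  (+ (2 ℕ.* n) + + (6 ℕ.* suc k)) - + 16     ≡⟨ cong (λ t → (+ (2 ℕ.* n) + t) - + 16) (ℤ.pos-* 6 (suc k)) ⟩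
  (+ (2 ℕ.* n) + + 6 * (+ 1 + + k)) - + 16   ≡⟨ distrib (+ (2 ℕ.* n)) (+ k) ⟩
  (+ (2 ℕ.* n) + + 6 * + k - + 16) + + 6     ≡⟨ cong (λ t → (+ (2 ℕ.* n) + t - + 16) + + 6) (sym (ℤ.pos-* 6 k)) ⟩
  prefixBound n k + + 6                      ∎
  where
  open ≡-Reasoning
  distrib : ∀ N k → (N + + 6 * (+ 1 + k)) - + 16 ≡ (N + + 6 * k - + 16) + + 6
  distrib = solve-∀

module _ {n} {x : Fin n → ℤ} (x∈A : InA n x) where
  private
    x-ordered : ∀ i j → i Fin.< j → x j ≤ x i
    x-ordered = proj₁ (proj₂ x∈A)
    x-nonNeg : ∀ i → + 0 ≤ x i
    x-nonNeg = proj₁ (proj₂ (proj₂ x∈A))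

  ext-nonNeg : ∀ j → + 0 ≤ ext x j
  ext-nonNeg j with j ℕ.<? n
  ... | yes j<n = subst (+ 0 ≤_) (sym (ext-fromℕ< x j<n)) (x-nonNeg _)
  ... | no  j≮n = ℤ.≤-reflexive (sym (ext-beyond x (ℕ.≮⇒≥ j≮n)))

  ext-antitone : ∀ {j k} → j ℕ.≤ k → ext x k ≤ ext x j
  ext-antitone {j} {k} j≤k with k ℕ.<? n | ℕ.m≤n⇒m<n∨m≡n j≤k
  ... | no  k≮n | _         = subst (_≤ ext x j) (sym (ext-beyond x (ℕ.≮⇒≥ k≮n))) (ext-nonNeg j)
  ... | yes _   | inj₂ refl = ℤ.≤-refl
  ... | yes k<n | inj₁ j<k  =
    subst₂ _≤_ (sym (ext-fromℕ< x k<n)) (sym (ext-fromℕ< x j<n))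
           (x-ordered _ _ (subst₂ ℕ._<_ (sym (Finₚ.toℕ-fromℕ< j<n)) (sym (Finₚ.toℕ-fromℕ< k<n)) j<k))
    where
    j<n : j ℕ.< n
    j<n = ℕ.<-trans j<k k<n

InA-tabulate : ∀ n (g : ℕ → ℤ) →
  (∀ k → k ℕ.< n → g k ≤ + n) →
  (∀ k → suc k ℕ.< n → g (suc k) ≤ g k) →
  (∀ k → k ℕ.< n → + 0 ≤ g k) →
  (∀ k → 1 ℕ.≤ k → k ℕ.≤ n → sumTo g k ≤ prefixBound n k) →
  sumTo g n ≤ + (6 ℕ.* n) - + 12 →
  InA n (λ i → g (toℕ i))
InA-tabulate n g g≤n g-steps g-nonNeg g-prefix g-total =
  (λ i → g≤n _ (Finₚ.toℕ<n i)) ,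
  (λ i j i<j → antitone-from-steps g g-steps (ℕ.<⇒≤ i<j) (Finₚ.toℕ<n j)) ,
  (λ i → g-nonNeg _ (Finₚ.toℕ<n i)) ,
  (λ k 1≤k k≤n → subst (_≤ prefixBound n k) (sym (prefix≡ k≤n)) (g-prefix k 1≤k k≤n)) ,
  subst (_≤ _) (sym (prefix≡ ℕ.≤-refl)) g-total
  where
  prefix≡ : ∀ {k} → k ℕ.≤ n → prefix {n} (λ i → g (toℕ i)) k ≡ sumTo g k
  prefix≡ {k} k≤n = sumTo-cong k (λ j j<k → ext-tabulate {n} g (ℕ.<-≤-trans j<k k≤n))

S-tabulate : ∀ n (g : ℕ → ℤ) → S n (λ i → g (toℕ i)) ≡ S′ n g
S-tabulate n g = S′-cong n (λ k k<n → ext-tabulate {n} g k<n)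

-- The increase of S when one unit moves from each of x_m, x_{m+1} to each of x₁, x₂, where
-- f₀, f₁, c, d are x₁, x₂, x_m, x_{m+1}, P = x₁ + ⋯ + x_{m-1} and Q = x₁² + ⋯ + x_m².
transferGain : (f₀ f₁ c d P Q : ℤ) → ℤ
transferGain f₀ f₁ c d P Q =
  (Q - f₀ * f₀) + (Q - f₀ * f₀ - f₁ * f₁) + d * d + (+ 2 * f₁ + + 1) * (f₀ + + 1)
  + (+ 1 - + 2 * c) * (P + + 2) + (+ 1 - + 2 * d) * (P + c + + 1)

transferGain-pos : ∀ {f₀ f₁ c d P Q} → + 0 ≤ f₁ → f₁ ≤ f₀ → + 0 ≤ d → d ≤ c →
                   c * P < f₁ * f₁ → + 4 * c ≤ f₁ → + 3 * c ≤ P →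
                   c * (P + c - (f₀ + f₁)) ≤ Q - (f₀ * f₀ + f₁ * f₁) →
                   + 0 < transferGain f₀ f₁ c d P Q
transferGain-pos {f₀} {f₁} {c} {d} {P} {Q} 0≤f₁ f₁≤f₀ 0≤d d≤c cP<f₁² 4c≤f₁ 3c≤P c*mid≤mid² =
  subst (+ 0 <_) (sym (gain≡ f₀ f₁ c d P Q)) (ℤ.+-mono-<-≤ (+<+ (s≤s z≤n))
    (*-nonNeg (≥0 f₁≤f₀) 0≤f₁ ⊕ 2* (≥0 (ℤ.i<j⇒suc[i]≤j cP<f₁²)) ⊕ *-nonNeg 0≤f₀ (≥0 4c≤f₁)
     ⊕ 2* (*-nonNeg 0≤c (≥0 f₁≤f₀)) ⊕ 2* 0≤f₁ ⊕ 0≤f₀ ⊕ 2* (≥0 3c≤P) ⊕ 0≤c ⊕ *-nonNeg 0≤d 0≤d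
     ⊕ 2* (≥0 c*mid≤mid²) ⊕ 2* (*-nonNeg (≥0 d≤c) (0≤P ⊕ 0≤c ⊕ +≤+ {0} {1} z≤n)) ⊕ +≤+ {0} {5} z≤n))
  where
  infixl 6 _⊕_
  _⊕_ : ∀ {i j : ℤ} → + 0 ≤ i → + 0 ≤ j → + 0 ≤ i + j
  _⊕_ = ℤ.+-mono-≤
  2* : ∀ {i} → + 0 ≤ i → + 0 ≤ + 2 * i
  2* = *-nonNeg {+ 2} (+≤+ z≤n)
  ≥0 : ∀ {i j} → i ≤ j → + 0 ≤ j - i
  ≥0 = ℤ.i≤j⇒0≤j-i
  0≤c : + 0 ≤ c
  0≤c = ℤ.≤-trans 0≤d d≤c
  0≤f₀ : + 0 ≤ f₀
  0≤f₀ = ℤ.≤-trans 0≤f₁ f₁≤f₀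
  0≤P : + 0 ≤ P
  0≤P = ℤ.≤-trans (*-nonNeg {+ 3} (+≤+ z≤n) 0≤c) 3c≤P

  gain≡ : ∀ f₀ f₁ c d P Q →
          (Q - f₀ * f₀) + (Q - f₀ * f₀ - f₁ * f₁) + d * d + (+ 2 * f₁ + + 1) * (f₀ + + 1)
          + (+ 1 - + 2 * c) * (P + + 2) + (+ 1 - + 2 * d) * (P + c + + 1) ≡
          + 1 + ((f₀ - f₁) * f₁ + + 2 * (f₁ * f₁ - (+ 1 + c * P)) + f₀ * (f₁ - + 4 * c) + + 2 * (c * (f₀ - f₁))
                 + + 2 * f₁ + f₀ + + 2 * (P - + 3 * c) + c + d * d
                 + + 2 * ((Q - (f₀ * f₀ + f₁ * f₁)) - c * (P + c - (f₀ + f₁)))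
                 + + 2 * ((c - d) * (P + c + + 1)) + + 5)
  gain≡ = solve-∀

-- Positions are 0-based (f j is x_{j+1}), so a + 1 is the m of the proof sketch above.
module Transfer
  {n : ℕ} {f : ℕ → ℤ}
  (f-nonNeg   : ∀ j → + 0 ≤ f j)
  (f-antitone : ∀ {j k} → j ℕ.≤ k → f k ≤ f j)
  (f-prefix   : ∀ k → 1 ℕ.≤ k → k ℕ.≤ n → sumTo f k ≤ prefixBound n k)
  (f-total    : sumTo f n ≤ + (6 ℕ.* n) - + 12)
  (f₀<n       : f 0 < + n)
  (n<18f₁     : + n < + 18 * f 1)
  {a : ℕ} (11663≤a : 11663 ℕ.≤ a) (1+a<n : suc a ℕ.< n)
  (7≤f[1+a] : + 7 ≤ f (suc a)) (f[2+a]<7 : f (suc (suc a)) < + 7)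
  where

  b : ℕ
  b = suc a

  f₀ f₁ c d P Q : ℤ
  f₀ = f 0
  f₁ = f 1
  c  = f a
  d  = f b
  P  = sumTo f a
  Q  = sumSq f b

  g₁ g₂ g₃ g : ℕ → ℤ
  g₁ = f  [ 0 ]+= + 1
  g₂ = g₁ [ 1 ]+= + 1
  g₃ = g₂ [ a ]+= - + 1
  g  = g₃ [ b ]+= - + 1

  1<a : 1 ℕ.< a
  1<a = ℕ.<-≤-trans (s≤s (s≤s z≤n)) 11663≤a
  a<b : a ℕ.< b
  a<b = ℕ.n<1+n a
  a<n : a ℕ.< n
  a<n = ℕ.<-trans a<b 1+a<n
  1<n : 1 ℕ.< n
  1<n = ℕ.<-trans 1<a a<n
  0<n : 0 ℕ.< n
  0<n = ℕ.<-trans (s≤s z≤n) 1<n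
  a≢0 : a ≢ 0
  a≢0 = ℕ.>⇒≢ (ℕ.<-trans (s≤s z≤n) 1<a)
  a≢1 : a ≢ 1
  a≢1 = ℕ.>⇒≢ 1<a

  0≢1 : 0 ≢ 1
  0≢1 ()
  0≢b : 0 ≢ b
  0≢b ()
  1≢0 : 1 ≢ 0
  1≢0 ()
  1≢b : 1 ≢ b
  1≢b = a≢0 ∘ sym ∘ ℕ.suc-injective
  b≢0 : b ≢ 0
  b≢0 ()

  g-0 : g 0 ≡ f₀ + + 1
  g-0 = trans (+=-elsewhere g₃ (- + 1) 0≢b) (trans (+=-elsewhere g₂ (- + 1) (a≢0 ∘ sym))
              (trans (+=-elsewhere g₁ (+ 1) 0≢1) (+=-at f 0 (+ 1))))

  g₁-1 : g₁ 1 ≡ f₁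
  g₁-1 = +=-elsewhere f (+ 1) 1≢0

  g-1 : g 1 ≡ f₁ + + 1
  g-1 = trans (+=-elsewhere g₃ (- + 1) 1≢b) (trans (+=-elsewhere g₂ (- + 1) (a≢1 ∘ sym))
              (trans (+=-at g₁ 1 (+ 1)) (cong (_+ + 1) g₁-1)))

  g₂-a : g₂ a ≡ c
  g₂-a = trans (+=-elsewhere g₁ (+ 1) a≢1) (+=-elsewhere f (+ 1) a≢0)

  g-a : g a ≡ c - + 1
  g-a = trans (+=-elsewhere g₃ (- + 1) (ℕ.<⇒≢ a<b)) (trans (+=-at g₂ a (- + 1)) (cong (_- + 1) g₂-a))

  g₃-b : g₃ b ≡ d
  g₃-b = trans (+=-elsewhere g₂ (- + 1) (ℕ.>⇒≢ a<b))
               (trans (+=-elsewhere g₁ (+ 1) (1≢b ∘ sym)) (+=-elsewhere f (+ 1) b≢0))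

  g-b : g b ≡ d - + 1
  g-b = trans (+=-at g₃ b (- + 1)) (cong (_- + 1) g₃-b)

  g-elsewhere : ∀ {k} → k ≢ 0 → k ≢ 1 → k ≢ a → k ≢ b → g k ≡ f k
  g-elsewhere k≢0 k≢1 k≢a k≢b =
    trans (+=-elsewhere g₃ (- + 1) k≢b) (trans (+=-elsewhere g₂ (- + 1) k≢a)
          (trans (+=-elsewhere g₁ (+ 1) k≢1) (+=-elsewhere f (+ 1) k≢0)))

  6≤c-1 : + 6 ≤ c - + 1
  6≤c-1 = ℤ.+-monoˡ-≤ (- + 1) (ℤ.≤-trans 7≤f[1+a] (f-antitone (ℕ.n≤1+n a)))

  6≤d-1 : + 6 ≤ d - + 1
  6≤d-1 = ℤ.+-monoˡ-≤ (- + 1) 7≤f[1+a]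

  f≤g : ∀ k → k ≢ a → k ≢ b → f k ≤ g k
  f≤g k k≢a k≢b with k ℕ.≟ 0 | k ℕ.≟ 1
  ... | yes refl | _        = subst (f₀ ≤_) (sym g-0) (i≤i+j-nonNeg f₀ (+≤+ z≤n))
  ... | no  _    | yes refl = subst (f₁ ≤_) (sym g-1) (i≤i+j-nonNeg f₁ (+≤+ z≤n))
  ... | no  k≢0  | no  k≢1  = ℤ.≤-reflexive (sym (g-elsewhere k≢0 k≢1 k≢a k≢b))

  g≤f : ∀ k → k ≢ 0 → k ≢ 1 → g k ≤ f k
  g≤f k k≢0 k≢1 with k ℕ.≟ a | k ℕ.≟ b
  ... | yes k≡a  | _        = subst (λ j → g j ≤ f j) (sym k≡a) (subst (_≤ c) (sym g-a) (ℤ.i-j≤i c (+ 1)))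
  ... | no  _    | yes refl = subst (_≤ d) (sym g-b) (ℤ.i-j≤i d (+ 1))
  ... | no  k≢a  | no  k≢b  = ℤ.≤-reflexive (g-elsewhere k≢0 k≢1 k≢a k≢b)

  f-1≤g : ∀ k → f k - + 1 ≤ g k
  f-1≤g k with k ℕ.≟ a | k ℕ.≟ b
  ... | yes k≡a  | _        = subst (λ j → f j - + 1 ≤ g j) (sym k≡a) (ℤ.≤-reflexive (sym g-a))
  ... | no  _    | yes refl = ℤ.≤-reflexive (sym g-b)
  ... | no  k≢a  | no  k≢b  = ℤ.≤-trans (ℤ.i-j≤i (f k) (+ 1)) (f≤g k k≢a k≢b)

  decremented-step : ∀ k → g (suc k) ≡ f (suc k) - + 1 → g (suc k) ≤ g k
  decremented-step k eq = ℤ.≤-trans (ℤ.≤-reflexive eq)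
                                    (ℤ.≤-trans (ℤ.+-monoˡ-≤ (- + 1) (f-antitone (ℕ.n≤1+n k))) (f-1≤g k))

  untouched-step : ∀ k → suc k ≢ a → k ≢ a → k ≢ b → g (suc k) ≤ g k
  untouched-step zero    _     _     _     = subst₂ _≤_ (sym g-1) (sym g-0) (ℤ.+-monoˡ-≤ (+ 1) (f-antitone z≤n))
  untouched-step (suc k) 2+k≢a 1+k≢a 1+k≢b =
    ℤ.≤-trans (g≤f (suc (suc k)) (λ ()) (λ ()))
              (ℤ.≤-trans (f-antitone (ℕ.n≤1+n (suc k))) (f≤g (suc k) 1+k≢a 1+k≢b))

  step-after-b : g (suc b) ≤ g b
  step-after-b = ℤ.≤-trans (g≤f (suc b) (λ ()) (λ ()))
                           (ℤ.≤-trans (ℤ.i<j⇒i≤pred[j] f[2+a]<7) (subst (+ 6 ≤_) (sym g-b) 6≤d-1))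

  g-steps : ∀ k → suc k ℕ.< n → g (suc k) ≤ g k
  g-steps k _ with suc k ℕ.≟ a | k ℕ.≟ a | k ℕ.≟ b
  ... | yes 1+k≡a | _       | _        =
    decremented-step k (trans (cong g 1+k≡a) (trans g-a (cong (λ j → f j - + 1) (sym 1+k≡a))))
  ... | no _      | yes k≡a | _        =
    decremented-step k (trans (cong (g ∘ suc) k≡a) (trans g-b (cong (λ j → f (suc j) - + 1) (sym k≡a))))
  ... | no _      | no _    | yes refl = step-after-b
  ... | no 1+k≢a  | no k≢a  | no k≢b   = untouched-step k 1+k≢a k≢a k≢b

  g-≤n : ∀ k → k ℕ.< n → g k ≤ + n
  g-≤n k k<n = ℤ.≤-trans (antitone-from-steps g g-steps z≤n k<n)
                         (subst (_≤ + n) (sym g-0) (i<j⇒i+1≤j f₀<n))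

  g-nonNeg : ∀ k → k ℕ.< n → + 0 ≤ g k
  g-nonNeg k _ with k ℕ.≟ a | k ℕ.≟ b
  ... | yes k≡a | _       = subst (λ j → + 0 ≤ g j) (sym k≡a) (subst (+ 0 ≤_) (sym g-a) (ℤ.≤-trans (+≤+ z≤n) 6≤c-1))
  ... | no _    | yes k≡b = subst (λ j → + 0 ≤ g j) (sym k≡b) (subst (+ 0 ≤_) (sym g-b) (ℤ.≤-trans (+≤+ z≤n) 6≤d-1))
  ... | no k≢a  | no k≢b  = ℤ.≤-trans (f-nonNeg k) (f≤g k k≢a k≢b)

  sumTo-g₂ : ∀ m → 1 ℕ.< m → sumTo g₂ m ≡ sumTo f m + + 1 + + 1
  sumTo-g₂ m 1<m = trans (sumTo-+=-> g₁ (+ 1) m 1<m) (cong (_+ + 1) (sumTo-+=-> f (+ 1) m (ℕ.<-trans (s≤s z≤n) 1<m)))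

  sumTo-g≤ : ∀ m → sumTo g m ≤ sumTo f m + + 1 + + 1
  sumTo-g≤ m = ℤ.≤-trans (sumTo-+=-nonPos g₃ m -≤+) (ℤ.≤-trans (sumTo-+=-nonPos g₂ m -≤+)
                 (ℤ.≤-trans (sumTo-+=-nonNeg g₁ m (+≤+ z≤n)) (ℤ.+-monoˡ-≤ (+ 1) (sumTo-+=-nonNeg f m (+≤+ z≤n)))))

  sumTo-g₃-b : sumTo g₃ b ≡ P + + 1 + + 1 + c - + 1
  sumTo-g₃-b = trans (sumTo-+=-> g₂ (- + 1) b a<b) (cong₂ (λ s t → s + t - + 1) (sumTo-g₂ a 1<a) g₂-a)

  sumTo-g-b : sumTo g b ≡ sumTo f b + + 1
  sumTo-g-b = trans (sumTo-+=-≤ g₃ (- + 1) b ℕ.≤-refl) (trans sumTo-g₃-b (cancel P c))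
    where
    cancel : ∀ P c → P + + 1 + + 1 + c - + 1 ≡ P + c + + 1
    cancel = solve-∀

  sumTo-g-beyond : ∀ m → b ℕ.< m → sumTo g m ≡ sumTo f m
  sumTo-g-beyond m b<m = begin
    sumTo g m                                       ≡⟨ sumTo-+=-> g₃ (- + 1) m b<m ⟩
    sumTo g₃ m - + 1                                ≡⟨ cong (_- + 1) (sumTo-+=-> g₂ (- + 1) m a<m) ⟩
    sumTo g₂ m - + 1 - + 1                          ≡⟨ cong (λ s → s - + 1 - + 1) (sumTo-g₂ m (ℕ.<-trans 1<a a<m)) ⟩
    sumTo f m + + 1 + + 1 - + 1 - + 1               ≡⟨ cancel (sumTo f m) ⟩
    sumTo f m                                       ∎
    where
    open ≡-Reasoning
    a<m : a ℕ.< m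
    a<m = ℕ.<-trans a<b b<m
    cancel : ∀ s → s + + 1 + + 1 - + 1 - + 1 ≡ s
    cancel = solve-∀

  f-slack : ∀ k t → k ℕ.+ t ≡ suc b → sumTo f k + + t ≤ prefixBound n k
  f-slack = sumTo-slack f (prefixBound n) (+ 6) (suc b) (λ k → ℤ.≤-reflexive (prefixBound-suc n k))
                        (λ j j<2+a → ℤ.≤-trans 7≤f[1+a] (f-antitone (ℕ.≤-pred j<2+a)))
                        (f-prefix (suc b) (s≤s z≤n) 1+a<n)

  g-prefix-≤a : ∀ k t → k ℕ.+ t ≡ a → sumTo g k ≤ prefixBound n k
  g-prefix-≤a k t k+t≡a = begin
    sumTo g k                    ≤⟨ sumTo-g≤ k ⟩
    sumTo f k + + 1 + + 1        ≡⟨ ℤ.+-assoc (sumTo f k) (+ 1) (+ 1) ⟩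
    sumTo f k + + 2              ≤⟨ ℤ.+-monoʳ-≤ (sumTo f k) (+≤+ (ℕ.m≤m+n 2 t)) ⟩
    sumTo f k + + (2 ℕ.+ t)      ≤⟨ f-slack k (2 ℕ.+ t) k+[2+t]≡2+a ⟩
    prefixBound n k              ∎
    where
    open ℤ.≤-Reasoning
    k+[2+t]≡2+a : k ℕ.+ (2 ℕ.+ t) ≡ suc b
    k+[2+t]≡2+a = trans (ℕ.+-suc k (suc t)) (cong suc (trans (ℕ.+-suc k t) (cong suc k+t≡a)))

  g-prefix : ∀ k → 1 ℕ.≤ k → k ℕ.≤ n → sumTo g k ≤ prefixBound n k
  g-prefix k 1≤k k≤n with ℕ.<-cmp k b
  ... | tri< k<b _ _ = let t , k+t≡a = ℕ.m≤n⇒∃[o]m+o≡n (ℕ.≤-pred k<b) in g-prefix-≤a k t k+t≡a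
  ... | tri≈ _ refl _ = ℤ.≤-trans (ℤ.≤-reflexive sumTo-g-b) (f-slack b 1 (ℕ.+-comm b 1))
  ... | tri> _ _ b<k = subst (_≤ prefixBound n k) (sym (sumTo-g-beyond k b<k)) (f-prefix k 1≤k k≤n)

  g-total : sumTo g n ≤ + (6 ℕ.* n) - + 12
  g-total = subst (_≤ _) (sym (sumTo-g-beyond n 1+a<n)) f-total

  g∈A : InA n (λ i → g (toℕ i))
  g∈A = InA-tabulate n g g-≤n g-steps g-nonNeg g-prefix g-total

  N : ℤ
  N = sumSq f n

  tail₁ : ∀ m → 0 ℕ.< m → sumSq g₁ n - sumSq g₁ m ≡ N - sumSq f m
  tail₁ m 0<m = sumSq-tail-+= f (+ 1) m n 0<m 0<n

  tail₂ : ∀ m → 1 ℕ.< m → sumSq g₂ n - sumSq g₂ m ≡ N - sumSq f m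
  tail₂ m 1<m = trans (sumSq-tail-+= g₁ (+ 1) m n 1<m 1<n) (tail₁ m (ℕ.<-trans (s≤s z≤n) 1<m))

  tail₃ : ∀ m → a ℕ.< m → sumSq g₃ n - sumSq g₃ m ≡ N - sumSq f m
  tail₃ m a<m = trans (sumSq-tail-+= g₂ (- + 1) m n a<m a<n) (tail₂ m (ℕ.<-trans 1<a a<m))

  S′-step : ∀ h {r} v {x Pr T} → r ℕ.< n → h r ≡ x → sumTo h r ≡ Pr → sumSq h n - sumSq h (suc r) ≡ T →
            S′ n (h [ r ]+= v) ≡ S′ n h + v * ((+ 2 * x + v) * Pr + T)
  S′-step h v r<n refl refl refl = S′-+= n h v r<n

  S′-g : S′ n g ≡ S′ n f + transferGain f₀ f₁ c d P Q
  S′-g = begin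
    S′ n g
      ≡⟨ S′-step g₃ (- + 1) 1+a<n g₃-b sumTo-g₃-b (tail₃ (suc b) (ℕ.<-trans a<b (ℕ.n<1+n b))) ⟩
    S′ n g₃ + Δ₄
      ≡⟨ cong (_+ Δ₄) (S′-step g₂ (- + 1) a<n g₂-a (sumTo-g₂ a 1<a) (tail₂ b (ℕ.<-trans 1<a a<b))) ⟩
    S′ n g₂ + Δ₃ + Δ₄
      ≡⟨ cong (λ s → s + Δ₃ + Δ₄) (S′-step g₁ (+ 1) 1<n g₁-1 (sumTo-+=-> f (+ 1) 1 (s≤s z≤n)) (tail₁ 2 (s≤s z≤n))) ⟩
    S′ n g₁ + Δ₂ + Δ₃ + Δ₄
      ≡⟨ cong (λ s → s + Δ₂ + Δ₃ + Δ₄) (S′-step f (+ 1) 0<n refl refl refl) ⟩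
    S′ n f + Δ₁ + Δ₂ + Δ₃ + Δ₄
      ≡⟨ collect (S′ n f) f₀ f₁ c d P Q N ⟩
    S′ n f + transferGain f₀ f₁ c d P Q ∎
    where
    open ≡-Reasoning
    Δ₁ Δ₂ Δ₃ Δ₄ : ℤ
    Δ₁ = + 1 * ((+ 2 * f₀ + + 1) * + 0 + (N - (+ 0 + f₀ * f₀)))
    Δ₂ = + 1 * ((+ 2 * f₁ + + 1) * (+ 0 + f₀ + + 1) + (N - (+ 0 + f₀ * f₀ + f₁ * f₁)))
    Δ₃ = - + 1 * ((+ 2 * c - + 1) * (P + + 1 + + 1) + (N - Q))
    Δ₄ = - + 1 * ((+ 2 * d - + 1) * (P + + 1 + + 1 + c - + 1) + (N - (Q + d * d)))
    collect : ∀ S f₀ f₁ c d P Q N →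
      S + + 1 * ((+ 2 * f₀ + + 1) * + 0 + (N - (+ 0 + f₀ * f₀)))
        + + 1 * ((+ 2 * f₁ + + 1) * (+ 0 + f₀ + + 1) + (N - (+ 0 + f₀ * f₀ + f₁ * f₁)))
        + - + 1 * ((+ 2 * c - + 1) * (P + + 1 + + 1) + (N - Q))
        + - + 1 * ((+ 2 * d - + 1) * (P + + 1 + + 1 + c - + 1) + (N - (Q + d * d)))
      ≡ S + ((Q - f₀ * f₀) + (Q - f₀ * f₀ - f₁ * f₁) + d * d + (+ 2 * f₁ + + 1) * (f₀ + + 1)
             + (+ 1 - + 2 * c) * (P + + 2) + (+ 1 - + 2 * d) * (P + c + + 1))
    collect = solve-∀

  T : ℤ
  T = + (6 ℕ.* n) - + 12

  0≤c : + 0 ≤ c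
  0≤c = f-nonNeg a

  0≤P : + 0 ≤ P
  0≤P = sumTo-monoʳ-≤ f a (λ j _ → f-nonNeg j) z≤n

  sumTo-f-1+a≤T : sumTo f (suc a) ≤ T
  sumTo-f-1+a≤T = ℤ.≤-trans (sumTo-monoʳ-≤ f n (λ j _ → f-nonNeg j) (ℕ.<⇒≤ 1+a<n)) f-total

  P≤T : P ≤ T
  P≤T = ℤ.≤-trans (i≤i+j-nonNeg P 0≤c) sumTo-f-1+a≤T

  [1+a]c≤T : + suc a * c ≤ T
  [1+a]c≤T = ℤ.≤-trans (*-≤-sumTo f c (suc a) (λ j j<1+a → f-antitone (ℕ.≤-pred j<1+a))) sumTo-f-1+a≤T

  T<108f₁ : T < + 108 * f₁
  T<108f₁ = begin-strict
    T                        ≤⟨ ℤ.i-j≤i (+ (6 ℕ.* n)) (+ 12) ⟩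
    + (6 ℕ.* n)              ≡⟨ ℤ.pos-* 6 n ⟩
    + 6 * + n                <⟨ ℤ.*-monoˡ-<-pos (+ 6) n<18f₁ ⟩
    + 6 * (+ 18 * f₁)        ≡⟨ sym (ℤ.*-assoc (+ 6) (+ 18) f₁) ⟩
    + 108 * f₁               ∎
    where open ℤ.≤-Reasoning

  cP<f₁² : c * P < f₁ * f₁
  cP<f₁² = ℤ.*-cancelˡ-<-nonNeg (+ suc a) (begin-strict
    + suc a * (c * P)        ≡⟨ sym (ℤ.*-assoc (+ suc a) c P) ⟩
    + suc a * c * P          ≤⟨ *-mono-≤-nonNeg (*-nonNeg {+ suc a} (+≤+ z≤n) 0≤c) [1+a]c≤T 0≤P P≤T ⟩
    T * T                    <⟨ square-< (ℤ.≤-trans 0≤P P≤T) T<108f₁ ⟩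
    + 108 * f₁ * (+ 108 * f₁) ≡⟨ square-108 f₁ ⟩
    + 11664 * (f₁ * f₁)      ≤⟨ ℤ.*-monoʳ-≤-nonNeg (f₁ * f₁) {{nonNegative (*-nonNeg 0≤f₁ 0≤f₁)}} (+≤+ (s≤s 11663≤a)) ⟩
    + suc a * (f₁ * f₁)      ∎)
    where
    open ℤ.≤-Reasoning
    0≤f₁ : + 0 ≤ f₁
    0≤f₁ = f-nonNeg 1
    square-108 : ∀ x → + 108 * x * (+ 108 * x) ≡ + 11664 * (x * x)
    square-108 = solve-∀

  4c≤f₁ : + 4 * c ≤ f₁
  4c≤f₁ = ℤ.<⇒≤ (ℤ.*-cancelˡ-<-nonNeg (+ 108) (begin-strict
    + 108 * (+ 4 * c)        ≡⟨ sym (ℤ.*-assoc (+ 108) (+ 4) c) ⟩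
    + 432 * c                ≤⟨ ℤ.*-monoʳ-≤-nonNeg c {{nonNegative 0≤c}} (+≤+ 432≤1+a) ⟩
    + suc a * c              ≤⟨ [1+a]c≤T ⟩
    T                        <⟨ T<108f₁ ⟩
    + 108 * f₁               ∎))
    where
    open ℤ.≤-Reasoning
    432≤1+a : 432 ℕ.≤ suc a
    432≤1+a = ℕ.≤-trans (ℕ.m≤m+n 432 11232) (s≤s 11663≤a)

  3c≤P : + 3 * c ≤ P
  3c≤P = ℤ.≤-trans (ℤ.*-monoʳ-≤-nonNeg c {{nonNegative 0≤c}} (+≤+ {3} {a} (ℕ.≤-trans (ℕ.m≤m+n 3 11660) 11663≤a)))
                   (*-≤-sumTo f c a (λ j j<a → f-antitone (ℕ.<⇒≤ j<a)))

  c*mid≤mid² : c * (P + c - (f₀ + f₁)) ≤ Q - (f₀ * f₀ + f₁ * f₁)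
  c*mid≤mid² = subst₂ (λ s q → c * (P + c - s) ≤ Q - q)
    (cong (_+ f₁) (ℤ.+-identityˡ f₀)) (cong (_+ f₁ * f₁) (ℤ.+-identityˡ (f₀ * f₀)))
    (*-sumTo-≤-sumSq f 2 (suc a) 0≤c (λ j _ j<1+a → f-antitone (ℕ.≤-pred j<1+a)) (ℕ.<⇒≤ (s≤s 1<a)))

  S′-increases : S′ n f < S′ n g
  S′-increases = begin-strict
    S′ n f                                  ≡⟨ sym (ℤ.+-identityʳ (S′ n f)) ⟩
    S′ n f + + 0                            <⟨ ℤ.+-monoʳ-< (S′ n f) gain-pos ⟩
    S′ n f + transferGain f₀ f₁ c d P Q     ≡⟨ sym S′-g ⟩
    S′ n g                                  ∎
    where
    open ℤ.≤-Reasoning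
    gain-pos : + 0 < transferGain f₀ f₁ c d P Q
    gain-pos = transferGain-pos {Q = Q} (f-nonNeg 1) (f-antitone z≤n) (ℤ.≤-trans (+≤+ z≤n) 7≤f[1+a])
                                (f-antitone (ℕ.n≤1+n a)) cP<f₁² 4c≤f₁ 3c≤P c*mid≤mid²

improvable : ∀ {n} {x : Fin n → ℤ} → InA n x → ext x 0 < + n → + n < + 18 * ext x 1 → + 7 ≤ ext x 11664 →
             ∃[ y ] (InA n y × S n x < S n y)
improvable {n} {x} x∈A f₀<n n<18f₁ 7≤f[K] =
  transfer (lastIndex (λ j → + 7 ℤ.≤? ext x j) (ℕ.<⇒≤ (below-n 7≤f[K])) 7≤f[K] 7≰f[n])
  where
  7≰0 : ¬ (+ 7 ≤ + 0)
  7≰0 (+≤+ ())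

  below-n : ∀ {j} → + 7 ≤ ext x j → j ℕ.< n
  below-n {j} 7≤f[j] with j ℕ.<? n
  ... | yes j<n = j<n
  ... | no  j≮n = contradiction (subst (+ 7 ≤_) (ext-beyond x (ℕ.≮⇒≥ j≮n)) 7≤f[j]) 7≰0

  7≰f[n] : ¬ (+ 7 ≤ ext x n)
  7≰f[n] = 7≰0 ∘ subst (+ 7 ≤_) (ext-beyond x ℕ.≤-refl)

  transfer : ∃[ b ] (11664 ℕ.≤ b × + 7 ≤ ext x b × ¬ (+ 7 ≤ ext x (suc b))) → ∃[ y ] (InA n y × S n x < S n y)
  transfer (suc a , 11664≤1+a , 7≤f[1+a] , 7≰f[2+a]) =
    (λ i → g (toℕ i)) , g∈A , subst (S′ n (ext x) <_) (sym (S-tabulate n g)) S′-increases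
    where
    open Transfer (ext-nonNeg x∈A) (ext-antitone x∈A) (proj₁ (proj₂ (proj₂ (proj₂ x∈A))))
                  (proj₂ (proj₂ (proj₂ (proj₂ x∈A)))) f₀<n n<18f₁
                  (ℕ.≤-pred 11664≤1+a) (below-n 7≤f[1+a]) 7≤f[1+a] (ℤ.≰⇒> 7≰f[2+a])

lemma5 : (n : ℕ) → (n≥2 : n ≥ 2) → (x : Fin n → ℤ) → InA n x
       → (∀ (y : Fin n → ℤ) → InA n y → S n y ≤ S n x)
       → (x (first n≥2) ≡ + n)
         ⊎ (+ 18 * x (second n≥2) ≤ + n)
         ⊎ (∃[ k ] (k Data.Nat.≤ 11664 × (∀ (i : Fin n) → k Data.Nat.< Data.Nat.suc (toℕ i) → x i ≤ + 6)))
lemma5 n n≥2 x x∈A x-max with x (first n≥2) ℤ.≟ + n | + 18 * x (second n≥2) ℤ.≤? + n | ext x 11664 ℤ.≤? + 6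
... | yes x₁≡n | _         | _         = inj₁ x₁≡n
... | no _     | yes 18x₂≤n | _         = inj₂ (inj₁ 18x₂≤n)
... | no _     | no _      | yes f[K]≤6 =
  inj₂ (inj₂ (11664 , ℕ.≤-refl , λ i K<1+i →
    subst (_≤ + 6) (ext-toℕ x i) (ℤ.≤-trans (ext-antitone x∈A (ℕ.≤-pred K<1+i)) f[K]≤6)))
... | no x₁≢n  | no 18x₂≰n | no f[K]≰6 =
  let y , y∈A , Sx<Sy = improvable x∈A x₁<n n<18x₂ (ℤ.i<j⇒suc[i]≤j (ℤ.≰⇒> f[K]≰6))
  in contradiction (x-max y y∈A) (ℤ.<⇒≱ Sx<Sy)
  where
  x₁<n : ext x 0 < + n
  x₁<n = subst (_< + n) (sym (ext-fromℕ< x (ℕ.<-trans (s≤s z≤n) n≥2))) (ℤ.≤∧≢⇒< (proj₁ x∈A _) x₁≢n)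
  n<18x₂ : + n < + 18 * ext x 1
  n<18x₂ = subst (λ t → + n < + 18 * t) (sym (ext-fromℕ< x n≥2)) (ℤ.≰⇒> 18x₂≰n)
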